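{- Let $\Gamma=\{\Lambda_i\}_{i\in I}\subseteq S_c[X]$, $\Lambda_i=\overline{(\alpha_i,N_i)},\ \alpha_i\in S_c[X_{N_i}]$, $\Lambda=\overline{(\beta,N)},\ \beta\in S_c[X_N]$. Then $\Gamma\vdash\Lambda$ iff there exists a finite subset $J\subseteq I$ such that $\bigcap\limits_{i\in J}A_{\alpha_i}\subseteq A_{\beta}$.
   Context: An idempotent complement (I-C) semiring is a commutative semiring $(S,\circ,\cdot,\theta,1)$ in which every $s$ has a complement $s^c$ with $s\cdot s^c=\theta$, $s\circ s^c=1$, $s\cdot s=s$, $s\circ s=s$. Let $X=\{x_1,x_2,\cdots\}$ be a countable set, $X_N=\{x_1,\dots,x_N\}$, and $S_c[X_N]$ the free I-C semiring generated by $X_N$. $S_c[X]$ is the free I-C semiring generated by $X$, realized as the direct limit of the $S_c[X_N]$ under the natural embeddings $f_{NM}:S_c[X_N]\to S_c[X_M]$ ($N\le M$); its elements are classes $\overline{(\alpha,N)}$ with $\alpha\in S_c[X_N]$. For $\Gamma\subseteq S_c[X]$ and $\beta\in S_c[X]$, $\Gamma\vdash\beta$ means $\beta\equiv_\Gamma 1$, where $\equiv_\Gamma$ is the congruence on $S_c[X]$ generated by $\{(\alpha,1)\mid\alpha\in\Gamma\}$. $A_i$ (resp. $A_i^c$) is the set of all $k\in\mathbb{N}$ whose binary digit of weight $2^{i-1}$ is $1$ (resp. $0$). For $\alpha=U_1\circ\cdots\circ U_m\in S_c[X_N]$ with $U_i=x_1^{i_1}\cdots x_N^{i_N}$, where $x_l^h$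 denotes $1,x_l,x_l^c$ for $h=0,1,c$, set $A_\alpha=\bigcup_{i=1}^m\bigcap_{j=1}^N A_j^{i_j}$ with $A_j^{i_j}=\mathbb{N},A_j,A_j^c$ for $i_j=0,1,c$. -}

module Defs where

open import Data.Nat using (ℕ; zero; suc; _≤_; _⊔_)
open import Data.Nat.DivMod using (_/_; _%_)
open import Data.Nat.Properties using (m≤m⊔n; m≤n⊔m)
open import Data.Fin using (Fin; zero; suc; inject≤)
open import Data.Vec using (Vec; []; _∷_; lookup)
open import Data.List using (List; []; _∷_)
open import Data.List.Relation.Unary.Any using (Any)
open import Data.List.Membership.Propositional using (_∈_)
open import Data.Product using (Σ; Σ-syntax; _×_; _,_)
open import Data.Unit using (⊤)
open import Relation.Binary.PropositionalEquality using (_≡_)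

infixl 6 _⊕_
infixl 7 _⊗_

data Term (V : Set) : Set where
  var  : V → Term V
  θ    : Term V
  one  : Term V
  _⊕_  : Term V → Term V → Term V     -- the operation ∘
  _⊗_  : Term V → Term V → Term V     -- the operation ·
  _ᶜ   : Term V → Term V

rename : {V W : Set} → (V → W) → Term V → Term W
rename f (var v) = var (f v)
rename f θ = θ
rename f one = one
rename f (s ⊕ t) = rename f s ⊕ rename f t
rename f (s ⊗ t) = rename f s ⊗ rename f t
rename f (s ᶜ) = rename f s ᶜ

infix 4 _≈F_

data _≈F_ {V : Set} : Term V → Term V → Set where
  ≈refl  : ∀ {s} → s ≈F s
  ≈sym   : ∀ {s t} → s ≈F t → t ≈F s
  ≈trans : ∀ {s t u} → s ≈F t → t ≈F u → s ≈F u
  ⊕-cong : ∀ {s s′ t t′} → s ≈F s′ → t ≈F t′ → s ⊕ t ≈F s′ ⊕ t′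
  ⊗-cong : ∀ {s s′ t t′} → s ≈F s′ → t ≈F t′ → s ⊗ t ≈F s′ ⊗ t′
  ᶜ-cong : ∀ {s t} → s ≈F t → s ᶜ ≈F t ᶜ
  ⊕-assoc : ∀ s t u → (s ⊕ t) ⊕ u ≈F s ⊕ (t ⊕ u)
  ⊕-comm  : ∀ s t → s ⊕ t ≈F t ⊕ s
  ⊕-idˡ   : ∀ s → θ ⊕ s ≈F s
  ⊗-assoc : ∀ s t u → (s ⊗ t) ⊗ u ≈F s ⊗ (t ⊗ u)
  ⊗-comm  : ∀ s t → s ⊗ t ≈F t ⊗ s
  ⊗-idˡ   : ∀ s → one ⊗ s ≈F s
  distribˡ : ∀ s t u → s ⊗ (t ⊕ u) ≈F (s ⊗ t) ⊕ (s ⊗ u)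
  zeroˡ   : ∀ s → θ ⊗ s ≈F θ
  compl-⊗ : ∀ s → s ⊗ (s ᶜ) ≈F θ
  compl-⊕ : ∀ s → s ⊕ (s ᶜ) ≈F one
  idem-⊗  : ∀ s → s ⊗ s ≈F s
  idem-⊕  : ∀ s → s ⊕ s ≈F s

-- S_c[X_N]: carrier Term (Fin N), with equality _≈F_.
ScN : ℕ → Set
ScN N = Term (Fin N)

embed : ∀ {N M} → N ≤ M → ScN N → ScN M
embed N≤M = rename (λ j → inject≤ j N≤M)

-- S_c[X] as the direct limit of the S_c[X_N]: pairs (α , N) with
-- (α,N) ~ (α′,N′) iff they become equal in some S_c[X_K].

ScX : Set
ScX = Σ ℕ ScN

cls : (N : ℕ) → ScN N → ScX
cls N α = N , α

infix 4 _≈X_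
_≈X_ : ScX → ScX → Set
(N , α) ≈X (M , β) =
  Σ[ K ∈ ℕ ] Σ[ p ∈ N ≤ K ] Σ[ q ∈ M ≤ K ] (embed p α ≈F embed q β)

_⊕X_ : ScX → ScX → ScX
(N , α) ⊕X (M , β) = (N ⊔ M) , (embed (m≤m⊔n N M) α ⊕ embed (m≤n⊔m N M) β)

_⊗X_ : ScX → ScX → ScX
(N , α) ⊗X (M , β) = (N ⊔ M) , (embed (m≤m⊔n N M) α ⊗ embed (m≤n⊔m N M) β)

oneX : ScX
oneX = 0 , one

-- ≡_Γ : the congruence on S_c[X] generated by {(α,1) | α ∈ Γ},
-- for Γ = {Λ i}_{i ∈ I}.

data Cong {I : Set} (Λ : I → ScX) : ScX → ScX → Set where
  gen    : ∀ i → Cong Λ (Λ i) oneX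
  eq     : ∀ {a b} → a ≈X b → Cong Λ a b      -- includes reflexivity
  csym   : ∀ {a b} → Cong Λ a b → Cong Λ b a
  ctrans : ∀ {a b c} → Cong Λ a b → Cong Λ b c → Cong Λ a c
  c⊕     : ∀ {a a′ b b′} → Cong Λ a a′ → Cong Λ b b′ → Cong Λ (a ⊕X b) (a′ ⊕X b′)
  c⊗     : ∀ {a a′ b b′} → Cong Λ a a′ → Cong Λ b b′ → Cong Λ (a ⊗X b) (a′ ⊗X b′)

infix 3 _⊢_
_⊢_ : {I : Set} → (I → ScX) → ScX → Set
Γ ⊢ β = Cong Γ β oneX

-- Normal forms α = U_1 ∘ ⋯ ∘ U_m,  U_i = x_1^{i_1} ⋯ x_N^{i_N},
-- with exponents h ∈ {0, 1, c}.

data Exp : Set where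
  e0 e1 ec : Exp

Monomial : ℕ → Set
Monomial N = Vec Exp N

NF : ℕ → Set
NF N = List (Monomial N)

lit : ∀ {N} → Fin N → Exp → ScN N
lit l e0 = one
lit l e1 = var l
lit l ec = var l ᶜ

monoTerm : ∀ {N} → Monomial N → ScN N
monoTerm [] = one
monoTerm (h ∷ hs) = lit zero h ⊗ rename suc (monoTerm hs)

nfTerm : ∀ {N} → NF N → ScN N
nfTerm [] = θ
nfTerm (U ∷ Us) = monoTerm U ⊕ nfTerm Us

bit : ℕ → ℕ → ℕ
bit zero k = k % 2
bit (suc j) k = bit j (k / 2)

-- k ∈ A_{j+1}^{h}  (A^0 = ℕ, A^1 = A_{j+1}, A^c = A_{j+1}^c);
-- index j : Fin N stands for the variable x_{j+1}.
InA : ℕ → Exp → ℕ → Set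
InA j e0 k = ⊤
InA j e1 k = bit j k ≡ 1
InA j ec k = bit j k ≡ 0

InMono : ∀ {N} → Monomial N → ℕ → Set
InMono {N} U k = ∀ (j : Fin N) → InA (Data.Fin.toℕ j) (lookup U j) k

InA[_] : ∀ {N} → NF N → ℕ → Set
InA[ α ] k = Any (λ U → InMono U k) α

-- ⋂_{i ∈ J} A_{α_i} ⊆ A_β, J a finite subset of I given as a list
-- (the empty intersection is ℕ).
InterSub : {I : Set} (N : I → ℕ) (α : (i : I) → NF (N i)) →
           List I → {M : ℕ} → NF M → Set
InterSub N α J β = ∀ (k : ℕ) → (∀ {i} → i ∈ J → InA[ α i ] k) → InA[ β ] k

{-# OPTIONS --safe #-}
module Submission where

-- Evaluate terms in the two-element Boolean algebra, reading x_{j+1} at k ∈ ℕ as the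
-- binary digit of weight 2^j of k; a normal form α then holds at k exactly when k ∈ A_α.
-- This evaluation is complete: every term of S_c[X_n] equals its disjunctive normal form
-- ⨁_ρ ⟦t⟧ρ · m_ρ over the minterms m_ρ, and every assignment of n variables is the digit
-- pattern of some k. A derivation of Γ ⊢ β uses finitely many generators J, and is sound
-- at every k where all of them hold: ⋂_J A_{α_i} ⊆ A_β. Conversely, given that inclusion,
-- β = β ∘ ∏_J Λ_i ≡_Γ β ∘ 1 = 1.

open import Defs
open import Level using (0ℓ)
open import Data.Bool using (Bool; true; false; _∧_; _∨_; not; T)
open import Data.Bool.Properties
  using ( ∨-assoc; ∨-comm; ∨-idem; ∨-inverseʳ; ∨-identityʳ; ∨-zeroʳ
        ; ∧-assoc; ∧-comm; ∧-idem; ∧-inverseʳ; ∧-distribˡ-∨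
        ; T-≡; T-∧; T-∨ )
open import Data.Nat using (ℕ; zero; suc; _+_; _*_; _≤_; _<_; _⊔_; _≡ᵇ_; s≤s)
open import Data.Nat.Properties using (≤-refl; m≤m⊔n; m≤n⊔m; ≡ᵇ⇒≡; ≡⇒≡ᵇ)
open import Data.Nat.DivMod using (_/_; m%n<n; m*n%n≡0; [m+kn]%n≡m%n; m*n/n≡m; +-distrib-/-∣ʳ)
open import Data.Nat.Divisibility using (n∣m*n)
open import Data.Fin using (Fin; zero; suc; toℕ)
open import Data.Fin.Properties using (toℕ-inject≤; ∀-cons-⇔)
open import Data.Vec using (Vec; []; _∷_; lookup)
open import Data.List using (List; []; _∷_; _++_)
open import Data.List.Relation.Unary.All as All using (All; []; _∷_)
open import Data.List.Relation.Unary.All.Properties using (++⁻ˡ; ++⁻ʳ)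
open import Data.List.Relation.Unary.Any.Properties using (∷↔)
open import Data.Product using (Σ-syntax; _×_; _,_)
open import Data.Product.Function.NonDependent.Propositional using (_×-⇔_)
open import Data.Sum using (_⊎_)
open import Data.Sum.Function.Propositional using (_⊎-⇔_)
open import Data.Unit using (tt)
open import Data.Empty using (⊥-elim)
open import Function using (_∘_; _⇔_; mk⇔; Equivalence)
open import Function.Construct.Identity using (⇔-id)
open import Function.Construct.Composition using (_⇔-∘_)
import Function.Related.Propositional as Related
open import Relation.Binary.Bundles using (Setoid)
import Relation.Binary.Reasoning.Setoid as SetoidReasoning
open import Relation.Binary.PropositionalEquality
  using (_≡_; _≗_; refl; sym; trans; subst; cong; cong₂; module ≡-Reasoning)

open Equivalence using (to; from)

≈F-setoid : Set → Setoid 0ℓ 0ℓ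
≈F-setoid V = record
  { Carrier       = Term V
  ; _≈_           = _≈F_
  ; isEquivalence = record { refl = ≈refl ; sym = ≈sym ; trans = ≈trans }
  }

module ≈F-Reasoning {V : Set} = SetoidReasoning (≈F-setoid V)

module _ {V : Set} where

  ⊕-idʳ : (s : Term V) → s ⊕ θ ≈F s
  ⊕-idʳ s = ≈trans (⊕-comm s θ) (⊕-idˡ s)

  ⊗-idʳ : (s : Term V) → s ⊗ one ≈F s
  ⊗-idʳ s = ≈trans (⊗-comm s one) (⊗-idˡ s)

  zeroʳ : (s : Term V) → s ⊗ θ ≈F θ
  zeroʳ s = ≈trans (⊗-comm s θ) (zeroˡ s)

  distribʳ : (s t u : Term V) → (s ⊕ t) ⊗ u ≈F s ⊗ u ⊕ t ⊗ u
  distribʳ s t u =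
    ≈trans (⊗-comm _ u) (≈trans (distribˡ u s t) (⊕-cong (⊗-comm u s) (⊗-comm u t)))

rename-cong : ∀ {V W} (f : V → W) {s t : Term V} → s ≈F t → rename f s ≈F rename f t
rename-cong f ≈refl             = ≈refl
rename-cong f (≈sym p)          = ≈sym (rename-cong f p)
rename-cong f (≈trans p q)      = ≈trans (rename-cong f p) (rename-cong f q)
rename-cong f (⊕-cong p q)      = ⊕-cong (rename-cong f p) (rename-cong f q)
rename-cong f (⊗-cong p q)      = ⊗-cong (rename-cong f p) (rename-cong f q)
rename-cong f (ᶜ-cong p)        = ᶜ-cong (rename-cong f p)
rename-cong f (⊕-assoc s t u)   = ⊕-assoc _ _ _
rename-cong f (⊕-comm s t)      = ⊕-comm _ _
rename-cong f (⊕-idˡ s)         = ⊕-idˡ _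
rename-cong f (⊗-assoc s t u)   = ⊗-assoc _ _ _
rename-cong f (⊗-comm s t)      = ⊗-comm _ _
rename-cong f (⊗-idˡ s)         = ⊗-idˡ _
rename-cong f (distribˡ s t u)  = distribˡ _ _ _
rename-cong f (zeroˡ s)         = zeroˡ _
rename-cong f (compl-⊗ s)       = compl-⊗ _
rename-cong f (compl-⊕ s)       = compl-⊕ _
rename-cong f (idem-⊗ s)        = idem-⊗ _
rename-cong f (idem-⊕ s)        = idem-⊕ _

⟦_⟧ : ∀ {V} → Term V → (V → Bool) → Bool
⟦ var v ⟧ ρ = ρ v
⟦ θ ⟧ ρ     = false
⟦ one ⟧ ρ   = true
⟦ s ⊕ t ⟧ ρ = ⟦ s ⟧ ρ ∨ ⟦ t ⟧ ρ
⟦ s ⊗ t ⟧ ρ = ⟦ s ⟧ ρ ∧ ⟦ t ⟧ ρ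
⟦ s ᶜ ⟧ ρ   = not (⟦ s ⟧ ρ)

⟦rename⟧ : ∀ {V W} (f : V → W) (t : Term V) (ρ : W → Bool) → ⟦ rename f t ⟧ ρ ≡ ⟦ t ⟧ (ρ ∘ f)
⟦rename⟧ f (var v) ρ = refl
⟦rename⟧ f θ ρ       = refl
⟦rename⟧ f one ρ     = refl
⟦rename⟧ f (s ⊕ t) ρ = cong₂ _∨_ (⟦rename⟧ f s ρ) (⟦rename⟧ f t ρ)
⟦rename⟧ f (s ⊗ t) ρ = cong₂ _∧_ (⟦rename⟧ f s ρ) (⟦rename⟧ f t ρ)
⟦rename⟧ f (s ᶜ) ρ   = cong not (⟦rename⟧ f s ρ)

⟦⟧-cong : ∀ {V} (t : Term V) {ρ σ : V → Bool} → ρ ≗ σ → ⟦ t ⟧ ρ ≡ ⟦ t ⟧ σ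
⟦⟧-cong (var v) ρ≗σ = ρ≗σ v
⟦⟧-cong θ ρ≗σ       = refl
⟦⟧-cong one ρ≗σ     = refl
⟦⟧-cong (s ⊕ t) ρ≗σ = cong₂ _∨_ (⟦⟧-cong s ρ≗σ) (⟦⟧-cong t ρ≗σ)
⟦⟧-cong (s ⊗ t) ρ≗σ = cong₂ _∧_ (⟦⟧-cong s ρ≗σ) (⟦⟧-cong t ρ≗σ)
⟦⟧-cong (s ᶜ) ρ≗σ   = cong not (⟦⟧-cong s ρ≗σ)

≈F-sound : ∀ {V} {s t : Term V} → s ≈F t → ∀ ρ → ⟦ s ⟧ ρ ≡ ⟦ t ⟧ ρ
≈F-sound ≈refl ρ            = refl
≈F-sound (≈sym p) ρ         = sym (≈F-sound p ρ)
≈F-sound (≈trans p q) ρ     = trans (≈F-sound p ρ) (≈F-sound q ρ)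
≈F-sound (⊕-cong p q) ρ     = cong₂ _∨_ (≈F-sound p ρ) (≈F-sound q ρ)
≈F-sound (⊗-cong p q) ρ     = cong₂ _∧_ (≈F-sound p ρ) (≈F-sound q ρ)
≈F-sound (ᶜ-cong p) ρ       = cong not (≈F-sound p ρ)
≈F-sound (⊕-assoc s t u) ρ  = ∨-assoc (⟦ s ⟧ ρ) (⟦ t ⟧ ρ) (⟦ u ⟧ ρ)
≈F-sound (⊕-comm s t) ρ     = ∨-comm (⟦ s ⟧ ρ) (⟦ t ⟧ ρ)
≈F-sound (⊕-idˡ s) ρ        = refl
≈F-sound (⊗-assoc s t u) ρ  = ∧-assoc (⟦ s ⟧ ρ) (⟦ t ⟧ ρ) (⟦ u ⟧ ρ)
≈F-sound (⊗-comm s t) ρ     = ∧-comm (⟦ s ⟧ ρ) (⟦ t ⟧ ρ)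
≈F-sound (⊗-idˡ s) ρ        = refl
≈F-sound (distribˡ s t u) ρ = ∧-distribˡ-∨ (⟦ s ⟧ ρ) (⟦ t ⟧ ρ) (⟦ u ⟧ ρ)
≈F-sound (zeroˡ s) ρ        = refl
≈F-sound (compl-⊗ s) ρ      = ∧-inverseʳ (⟦ s ⟧ ρ)
≈F-sound (compl-⊕ s) ρ      = ∨-inverseʳ (⟦ s ⟧ ρ)
≈F-sound (idem-⊗ s) ρ       = ∧-idem (⟦ s ⟧ ρ)
≈F-sound (idem-⊕ s) ρ       = ∨-idem (⟦ s ⟧ ρ)

-- Completeness: disjunctive normal forms

module _ {V : Set} where

  infixr 7 _·ᵇ_

  _·ᵇ_ : Bool → Term V → Term V
  true  ·ᵇ m = m
  false ·ᵇ m = θ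

  ·ᵇ-⊕ : ∀ a b (m : Term V) → a ·ᵇ m ⊕ b ·ᵇ m ≈F (a ∨ b) ·ᵇ m
  ·ᵇ-⊕ true true m  = idem-⊕ m
  ·ᵇ-⊕ true false m = ⊕-idʳ m
  ·ᵇ-⊕ false b m    = ⊕-idˡ (b ·ᵇ m)

  ·ᵇ-⊗ : ∀ a (m n : Term V) → (a ·ᵇ m) ⊗ n ≈F a ·ᵇ (m ⊗ n)
  ·ᵇ-⊗ true m n  = ≈refl
  ·ᵇ-⊗ false m n = zeroˡ n

  ⊗-·ᵇ : ∀ a (m n : Term V) → m ⊗ (a ·ᵇ n) ≈F a ·ᵇ (m ⊗ n)
  ⊗-·ᵇ true m n  = ≈refl
  ⊗-·ᵇ false m n = zeroʳ m

  Decides : Term V → Term V → Bool → Set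
  Decides m s a = m ⊗ s ≈F a ·ᵇ m

  decides-⊕ : ∀ {m s t a b} → Decides m s a → Decides m t b → Decides m (s ⊕ t) (a ∨ b)
  decides-⊕ {m} {s} {t} {a} {b} ds dt = begin
    m ⊗ (s ⊕ t)          ≈⟨ distribˡ m s t ⟩
    m ⊗ s ⊕ m ⊗ t        ≈⟨ ⊕-cong ds dt ⟩
    a ·ᵇ m ⊕ b ·ᵇ m      ≈⟨ ·ᵇ-⊕ a b m ⟩
    (a ∨ b) ·ᵇ m         ∎
    where open ≈F-Reasoning

  decides-⊗ : ∀ {m s t a b} → Decides m s a → Decides m t b → Decides m (s ⊗ t) (a ∧ b)
  decides-⊗ {m} {s} {t} {a} {b} ds dt = begin
    m ⊗ (s ⊗ t)          ≈⟨ ⊗-assoc m s t ⟨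
    (m ⊗ s) ⊗ t          ≈⟨ ⊗-cong ds ≈refl ⟩
    (a ·ᵇ m) ⊗ t         ≈⟨ absorb a ⟩
    (a ∧ b) ·ᵇ m         ∎
    where
    open ≈F-Reasoning
    absorb : ∀ a → (a ·ᵇ m) ⊗ t ≈F (a ∧ b) ·ᵇ m
    absorb true  = dt
    absorb false = zeroˡ t

  decides-ᶜ : ∀ {m s} a → Decides m s a → Decides m (s ᶜ) (not a)
  decides-ᶜ {m} {s} true ds = begin
    m ⊗ s ᶜ              ≈⟨ ⊗-cong ds ≈refl ⟨
    (m ⊗ s) ⊗ s ᶜ        ≈⟨ ⊗-assoc m s (s ᶜ) ⟩
    m ⊗ (s ⊗ s ᶜ)        ≈⟨ ⊗-cong ≈refl (compl-⊗ s) ⟩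
    m ⊗ θ                ≈⟨ zeroʳ m ⟩
    θ                    ∎
    where open ≈F-Reasoning
  decides-ᶜ {m} {s} false ds = begin
    m ⊗ s ᶜ              ≈⟨ ⊕-idˡ _ ⟨
    θ ⊕ m ⊗ s ᶜ          ≈⟨ ⊕-cong ds ≈refl ⟨
    m ⊗ s ⊕ m ⊗ s ᶜ      ≈⟨ distribˡ m s (s ᶜ) ⟨
    m ⊗ (s ⊕ s ᶜ)        ≈⟨ ⊗-cong ≈refl (compl-⊕ s) ⟩
    m ⊗ one              ≈⟨ ⊗-idʳ m ⟩
    m                    ∎
    where open ≈F-Reasoning

  decides-extendʳ : ∀ {m s a} n → Decides m s a → Decides (m ⊗ n) s a
  decides-extendʳ {m} {s} {a} n ds = begin
    (m ⊗ n) ⊗ s          ≈⟨ ⊗-assoc m n s ⟩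
    m ⊗ (n ⊗ s)          ≈⟨ ⊗-cong ≈refl (⊗-comm n s) ⟩
    m ⊗ (s ⊗ n)          ≈⟨ ⊗-assoc m s n ⟨
    (m ⊗ s) ⊗ n          ≈⟨ ⊗-cong ds ≈refl ⟩
    (a ·ᵇ m) ⊗ n         ≈⟨ ·ᵇ-⊗ a m n ⟩
    a ·ᵇ (m ⊗ n)         ∎
    where open ≈F-Reasoning

  decides-extendˡ : ∀ {n s a} m → Decides n s a → Decides (m ⊗ n) s a
  decides-extendˡ {n} {s} {a} m ds = begin
    (m ⊗ n) ⊗ s          ≈⟨ ⊗-assoc m n s ⟩
    m ⊗ (n ⊗ s)          ≈⟨ ⊗-cong ≈refl ds ⟩
    m ⊗ (a ·ᵇ n)         ≈⟨ ⊗-·ᵇ a m n ⟩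
    a ·ᵇ (m ⊗ n)         ∎
    where open ≈F-Reasoning

  literal : V → Bool → Term V
  literal v true  = var v
  literal v false = var v ᶜ

  literal-decides : ∀ v b → Decides (literal v b) (var v) b
  literal-decides v true  = idem-⊗ (var v)
  literal-decides v false = ≈trans (⊗-comm (var v ᶜ) (var v)) (compl-⊗ (var v))

decides-rename : ∀ {V W} (f : V → W) {m s : Term V} {a} →
                 Decides m s a → Decides (rename f m) (rename f s) a
decides-rename f {a = true}  ds = rename-cong f ds
decides-rename f {a = false} ds = rename-cong f ds

minterm : ∀ {n} → Vec Bool n → Term (Fin n)
minterm []       = one
minterm (b ∷ bs) = literal zero b ⊗ rename suc (minterm bs)

minterm-decides-var : ∀ {n} (bs : Vec Bool n) j → Decides (minterm bs) (var j) (lookup bs j)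
minterm-decides-var (b ∷ bs) zero    = decides-extendʳ _ (literal-decides zero b)
minterm-decides-var (b ∷ bs) (suc j) =
  decides-extendˡ (literal zero b) (decides-rename suc (minterm-decides-var bs j))

minterm-decides : ∀ {n} (bs : Vec Bool n) t → Decides (minterm bs) t (⟦ t ⟧ (lookup bs))
minterm-decides bs (var j) = minterm-decides-var bs j
minterm-decides bs θ       = zeroʳ (minterm bs)
minterm-decides bs one     = ⊗-idʳ (minterm bs)
minterm-decides bs (s ⊕ t) = decides-⊕ (minterm-decides bs s) (minterm-decides bs t)
minterm-decides bs (s ⊗ t) = decides-⊗ (minterm-decides bs s) (minterm-decides bs t)
minterm-decides bs (s ᶜ)   = decides-ᶜ (⟦ s ⟧ (lookup bs)) (minterm-decides bs s)

module _ {V : Set} where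

  ⨁ : (n : ℕ) → (Vec Bool n → Term V) → Term V
  ⨁ zero    f = f []
  ⨁ (suc n) f = ⨁ n (f ∘ (true ∷_)) ⊕ ⨁ n (f ∘ (false ∷_))

  ⨁-cong : ∀ n {f g : Vec Bool n → Term V} → (∀ bs → f bs ≈F g bs) → ⨁ n f ≈F ⨁ n g
  ⨁-cong zero    f≈g = f≈g []
  ⨁-cong (suc n) f≈g = ⊕-cong (⨁-cong n (f≈g ∘ (true ∷_))) (⨁-cong n (f≈g ∘ (false ∷_)))

  ⨁-⊗ : ∀ n (f : Vec Bool n → Term V) t → ⨁ n f ⊗ t ≈F ⨁ n (λ bs → f bs ⊗ t)
  ⨁-⊗ zero    f t = ≈refl
  ⨁-⊗ (suc n) f t =
    ≈trans (distribʳ _ _ t) (⊕-cong (⨁-⊗ n (f ∘ (true ∷_)) t) (⨁-⊗ n (f ∘ (false ∷_)) t))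

  ⊗-⨁ : ∀ n s (f : Vec Bool n → Term V) → s ⊗ ⨁ n f ≈F ⨁ n (λ bs → s ⊗ f bs)
  ⊗-⨁ zero    s f = ≈refl
  ⊗-⨁ (suc n) s f =
    ≈trans (distribˡ s _ _) (⊕-cong (⊗-⨁ n s (f ∘ (true ∷_))) (⊗-⨁ n s (f ∘ (false ∷_))))

⨁-rename : ∀ {V W} (g : V → W) n (f : Vec Bool n → Term V) →
           rename g (⨁ n f) ≡ ⨁ n (rename g ∘ f)
⨁-rename g zero    f = refl
⨁-rename g (suc n) f = cong₂ _⊕_ (⨁-rename g n (f ∘ (true ∷_))) (⨁-rename g n (f ∘ (false ∷_)))

⨁-minterm : ∀ n → ⨁ n minterm ≈F one
⨁-minterm zero    = ≈refl
⨁-minterm (suc n) = begin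
  ⨁ n (λ bs → x ⊗ R bs) ⊕ ⨁ n (λ bs → x ᶜ ⊗ R bs)     ≈⟨ ⊕-cong (⊗-⨁ n x R) (⊗-⨁ n (x ᶜ) R) ⟨
  x ⊗ ⨁ n R ⊕ x ᶜ ⊗ ⨁ n R                             ≈⟨ distribʳ x (x ᶜ) (⨁ n R) ⟨
  (x ⊕ x ᶜ) ⊗ ⨁ n R                                   ≈⟨ ⊗-cong (compl-⊕ x) ≈refl ⟩
  one ⊗ ⨁ n R                                         ≈⟨ ⊗-idˡ (⨁ n R) ⟩
  ⨁ n R                                               ≡⟨ ⨁-rename suc n minterm ⟨
  rename suc (⨁ n minterm)                            ≈⟨ rename-cong suc (⨁-minterm n) ⟩
  one                                                 ∎
  where
  open ≈F-Reasoning
  x = var zero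
  R = rename suc ∘ minterm

disjunctive-normal-form : ∀ {n} (t : Term (Fin n)) →
                          t ≈F ⨁ n (λ bs → ⟦ t ⟧ (lookup bs) ·ᵇ minterm bs)
disjunctive-normal-form {n} t = begin
  t                                         ≈⟨ ⊗-idˡ t ⟨
  one ⊗ t                                   ≈⟨ ⊗-cong (⨁-minterm n) ≈refl ⟨
  ⨁ n minterm ⊗ t                           ≈⟨ ⨁-⊗ n minterm t ⟩
  ⨁ n (λ bs → minterm bs ⊗ t)               ≈⟨ ⨁-cong n (λ bs → minterm-decides bs t) ⟩
  ⨁ n (λ bs → ⟦ t ⟧ (lookup bs) ·ᵇ minterm bs) ∎
  where open ≈F-Reasoning

≈F-complete : ∀ {n} (s t : Term (Fin n)) →
              (∀ (bs : Vec Bool n) → ⟦ s ⟧ (lookup bs) ≡ ⟦ t ⟧ (lookup bs)) → s ≈F t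
≈F-complete {n} s t s≡t = begin
  s                                         ≈⟨ disjunctive-normal-form s ⟩
  ⨁ n (λ bs → ⟦ s ⟧ (lookup bs) ·ᵇ minterm bs)
    ≈⟨ ⨁-cong n (λ bs → reflexive (cong (_·ᵇ minterm bs) (s≡t bs))) ⟩
  ⨁ n (λ bs → ⟦ t ⟧ (lookup bs) ·ᵇ minterm bs) ≈⟨ disjunctive-normal-form t ⟨
  t                                         ∎
  where
  open ≈F-Reasoning
  open Setoid (≈F-setoid (Fin n)) using (reflexive)

-- The direct limit S_c[X], evaluated at the binary digits of k

bits : ∀ {N} → ℕ → Fin N → Bool
bits k j = bit (toℕ j) k ≡ᵇ 1

encode : ∀ {K} → Vec Bool K → ℕ
encode []           = 0
encode (false ∷ bs) = encode bs * 2
encode (true ∷ bs)  = 1 + encode bs * 2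

encode-/2 : ∀ {K} b (bs : Vec Bool K) → encode (b ∷ bs) / 2 ≡ encode bs
encode-/2 false bs = m*n/n≡m (encode bs) 2
encode-/2 true bs  = trans (+-distrib-/-∣ʳ 1 {d = 2} (n∣m*n (encode bs))) (m*n/n≡m (encode bs) 2)

bits-encode : ∀ {K} (bs : Vec Bool K) → bits (encode bs) ≗ lookup bs
bits-encode (false ∷ bs) zero    = cong (_≡ᵇ 1) (m*n%n≡0 (encode bs) 2)
bits-encode (true ∷ bs)  zero    = cong (_≡ᵇ 1) ([m+kn]%n≡m%n 1 (encode bs) 2)
bits-encode (b ∷ bs)     (suc j) = trans (cong (λ k → bits k j) (encode-/2 b bs)) (bits-encode bs j)

⟦_⟧X : ScX → ℕ → Bool
⟦ N , s ⟧X k = ⟦ s ⟧ (bits k)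

⟦embed⟧ : ∀ {N K} (p : N ≤ K) (s : ScN N) k → ⟦ embed p s ⟧ (bits k) ≡ ⟦ s ⟧ (bits k)
⟦embed⟧ p s k =
  trans (⟦rename⟧ _ s (bits k)) (⟦⟧-cong s (λ j → cong (λ n → bit n k ≡ᵇ 1) (toℕ-inject≤ j p)))

⟦⊕X⟧ : ∀ a b k → ⟦ a ⊕X b ⟧X k ≡ ⟦ a ⟧X k ∨ ⟦ b ⟧X k
⟦⊕X⟧ (N , s) (M , t) k = cong₂ _∨_ (⟦embed⟧ (m≤m⊔n N M) s k) (⟦embed⟧ (m≤n⊔m N M) t k)

⟦⊗X⟧ : ∀ a b k → ⟦ a ⊗X b ⟧X k ≡ ⟦ a ⟧X k ∧ ⟦ b ⟧X k
⟦⊗X⟧ (N , s) (M , t) k = cong₂ _∧_ (⟦embed⟧ (m≤m⊔n N M) s k) (⟦embed⟧ (m≤n⊔m N M) t k)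

≈X-refl : ∀ a → a ≈X a
≈X-refl (N , s) = N , ≤-refl , ≤-refl , ≈refl

≈X-sound : ∀ {a b} → a ≈X b → ∀ k → ⟦ a ⟧X k ≡ ⟦ b ⟧X k
≈X-sound {N , s} {M , t} (K , p , q , s≈t) k = begin
  ⟦ s ⟧ (bits k)          ≡⟨ ⟦embed⟧ p s k ⟨
  ⟦ embed p s ⟧ (bits k)  ≡⟨ ≈F-sound s≈t (bits k) ⟩
  ⟦ embed q t ⟧ (bits k)  ≡⟨ ⟦embed⟧ q t k ⟩
  ⟦ t ⟧ (bits k)          ∎
  where open ≡-Reasoning

≈X-complete : ∀ a b → (∀ k → ⟦ a ⟧X k ≡ ⟦ b ⟧X k) → a ≈X b
≈X-complete (N , s) (M , t) a≡b = N ⊔ M , p , q , ≈F-complete (embed p s) (embed q t) agree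
  where
  open ≡-Reasoning
  p = m≤m⊔n N M
  q = m≤n⊔m N M
  embed-at : ∀ {L} (r : L ≤ N ⊔ M) u bs → ⟦ embed r u ⟧ (lookup bs) ≡ ⟦ u ⟧ (bits (encode bs))
  embed-at r u bs = trans (⟦⟧-cong (embed r u) (sym ∘ bits-encode bs)) (⟦embed⟧ r u (encode bs))
  agree : ∀ bs → ⟦ embed p s ⟧ (lookup bs) ≡ ⟦ embed q t ⟧ (lookup bs)
  agree bs = begin
    ⟦ embed p s ⟧ (lookup bs)      ≡⟨ embed-at p s bs ⟩
    ⟦ s ⟧ (bits (encode bs))       ≡⟨ a≡b (encode bs) ⟩
    ⟦ t ⟧ (bits (encode bs))       ≡⟨ embed-at q t bs ⟨
    ⟦ embed q t ⟧ (lookup bs)      ∎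

-- Derivations from Γ

∨-absorbs-implied : ∀ {x y} → (T y → T x) → x ∨ y ≡ x
∨-absorbs-implied {x}     {false} _   = ∨-identityʳ x
∨-absorbs-implied {true}  {true}  _   = refl
∨-absorbs-implied {false} {true}  y⇒x = ⊥-elim (y⇒x tt)

Cong-setoid : {I : Set} → (I → ScX) → Setoid 0ℓ 0ℓ
Cong-setoid Λ = record
  { Carrier       = ScX
  ; _≈_           = Cong Λ
  ; isEquivalence = record { refl = eq (≈X-refl _) ; sym = csym ; trans = ctrans }
  }

generators : ∀ {I} {Λ : I → ScX} {a b} → Cong Λ a b → List I
generators (gen i)      = i ∷ []
generators (eq _)       = []
generators (csym d)     = generators d
generators (ctrans d e) = generators d ++ generators e
generators (c⊕ d e)     = generators d ++ generators e
generators (c⊗ d e)     = generators d ++ generators e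

HoldAt : {I : Set} → (I → ScX) → ℕ → List I → Set
HoldAt Λ k = All (λ i → T (⟦ Λ i ⟧X k))

infix 4 _⊨[_]_

_⊨[_]_ : {I : Set} → (I → ScX) → List I → ScX → Set
Λ ⊨[ J ] B = ∀ k → HoldAt Λ k J → T (⟦ B ⟧X k)

∏ : {I : Set} → (I → ScX) → List I → ScX
∏ Λ []      = oneX
∏ Λ (i ∷ J) = Λ i ⊗X ∏ Λ J

module _ {I : Set} {Λ : I → ScX} where

  Cong-sound : ∀ {a b} (d : Cong Λ a b) k → HoldAt Λ k (generators d) → ⟦ a ⟧X k ≡ ⟦ b ⟧X k
  Cong-sound (gen i) k (Λi ∷ [])   = to T-≡ Λi
  Cong-sound (eq a≈b) k _          = ≈X-sound a≈b k
  Cong-sound (csym d) k H          = sym (Cong-sound d k H)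
  Cong-sound (ctrans d e) k H      =
    trans (Cong-sound d k (++⁻ˡ (generators d) H)) (Cong-sound e k (++⁻ʳ (generators d) H))
  Cong-sound (c⊕ {a} {a′} {b} {b′} d e) k H = begin
    ⟦ a ⊕X b ⟧X k               ≡⟨ ⟦⊕X⟧ a b k ⟩
    ⟦ a ⟧X k ∨ ⟦ b ⟧X k         ≡⟨ cong₂ _∨_ (Cong-sound d k (++⁻ˡ (generators d) H))
                                             (Cong-sound e k (++⁻ʳ (generators d) H)) ⟩
    ⟦ a′ ⟧X k ∨ ⟦ b′ ⟧X k       ≡⟨ ⟦⊕X⟧ a′ b′ k ⟨
    ⟦ a′ ⊕X b′ ⟧X k             ∎
    where open ≡-Reasoning
  Cong-sound (c⊗ {a} {a′} {b} {b′} d e) k H = begin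
    ⟦ a ⊗X b ⟧X k               ≡⟨ ⟦⊗X⟧ a b k ⟩
    ⟦ a ⟧X k ∧ ⟦ b ⟧X k         ≡⟨ cong₂ _∧_ (Cong-sound d k (++⁻ˡ (generators d) H))
                                             (Cong-sound e k (++⁻ʳ (generators d) H)) ⟩
    ⟦ a′ ⟧X k ∧ ⟦ b′ ⟧X k       ≡⟨ ⟦⊗X⟧ a′ b′ k ⟨
    ⟦ a′ ⊗X b′ ⟧X k             ∎
    where open ≡-Reasoning

  ⊢⇒⊨ : ∀ {B} (d : Λ ⊢ B) → Λ ⊨[ generators d ] B
  ⊢⇒⊨ d k H = from T-≡ (Cong-sound d k H)

  ∏-⊢ : ∀ J → Λ ⊢ ∏ Λ J
  ∏-⊢ []      = eq (≈X-refl oneX)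
  ∏-⊢ (i ∷ J) = ctrans (c⊗ (gen i) (∏-⊢ J)) (eq (≈X-complete (oneX ⊗X oneX) oneX (λ _ → refl)))

  ⟦∏⟧ : ∀ J k → T (⟦ ∏ Λ J ⟧X k) → HoldAt Λ k J
  ⟦∏⟧ []      k _ = []
  ⟦∏⟧ (i ∷ J) k h with to T-∧ (subst T (⟦⊗X⟧ (Λ i) (∏ Λ J) k) h)
  ... | Λi , ∏J = Λi ∷ ⟦∏⟧ J k ∏J

  ⊨⇒⊢ : ∀ {J B} → Λ ⊨[ J ] B → Λ ⊢ B
  ⊨⇒⊢ {J} {B} J⊨B = begin
    B              ≈⟨ eq (≈X-complete B (B ⊕X ∏ Λ J) absorb) ⟩
    B ⊕X ∏ Λ J     ≈⟨ c⊕ (eq (≈X-refl B)) (∏-⊢ J) ⟩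
    B ⊕X oneX      ≈⟨ eq (≈X-complete (B ⊕X oneX) oneX absorb-one) ⟩
    oneX           ∎
    where
    open SetoidReasoning (Cong-setoid Λ)
    absorb : ∀ k → ⟦ B ⟧X k ≡ ⟦ B ⊕X ∏ Λ J ⟧X k
    absorb k = sym (trans (⟦⊕X⟧ B (∏ Λ J) k) (∨-absorbs-implied (J⊨B k ∘ ⟦∏⟧ J k)))
    absorb-one : ∀ k → ⟦ B ⊕X oneX ⟧X k ≡ ⟦ oneX ⟧X k
    absorb-one k = trans (⟦⊕X⟧ B oneX k) (∨-zeroʳ (⟦ B ⟧X k))

∀-cong-⇔ : ∀ {A : Set} {P Q : A → Set} → (∀ x → P x ⇔ Q x) → (∀ x → P x) ⇔ (∀ x → Q x)
∀-cong-⇔ P⇔Q = mk⇔ (λ p x → to (P⇔Q x) (p x)) (λ q x → from (P⇔Q x) (q x))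

⟦_⟧ᵉ : Exp → Bool → Bool
⟦ e0 ⟧ᵉ b = true
⟦ e1 ⟧ᵉ b = b
⟦ ec ⟧ᵉ b = not b

⟦lit⟧ : ∀ {N} (j : Fin N) e ρ → ⟦ lit j e ⟧ ρ ≡ ⟦ e ⟧ᵉ (ρ j)
⟦lit⟧ j e0 ρ = refl
⟦lit⟧ j e1 ρ = refl
⟦lit⟧ j ec ρ = refl

⟦monoTerm⟧ : ∀ {N} (U : Monomial N) ρ → T (⟦ monoTerm U ⟧ ρ) ⇔ (∀ j → T (⟦ lookup U j ⟧ᵉ (ρ j)))
⟦monoTerm⟧ []      ρ = mk⇔ (λ _ ()) _
⟦monoTerm⟧ (e ∷ U) ρ = begin
  T (⟦ lit zero e ⟧ ρ ∧ ⟦ rename suc (monoTerm U) ⟧ ρ)         ∼⟨ T-∧ ⟩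
  (T (⟦ lit zero e ⟧ ρ) × T (⟦ rename suc (monoTerm U) ⟧ ρ))   ≡⟨ cong₂ (λ x y → T x × T y)
                                                                   (⟦lit⟧ zero e ρ)
                                                                   (⟦rename⟧ suc (monoTerm U) ρ) ⟩
  (T (⟦ e ⟧ᵉ (ρ zero)) × T (⟦ monoTerm U ⟧ (ρ ∘ suc)))         ∼⟨ ⇔-id _ ×-⇔ ⟦monoTerm⟧ U (ρ ∘ suc) ⟩
  (T (⟦ e ⟧ᵉ (ρ zero)) × (∀ j → T (⟦ lookup U j ⟧ᵉ (ρ (suc j))))) ∼⟨ ∀-cons-⇔ ⟩
  (∀ j → T (⟦ lookup (e ∷ U) j ⟧ᵉ (ρ j)))                      ∎
  where open Related.EquationalReasoning

bit<2 : ∀ n k → bit n k < 2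
bit<2 zero    k = m%n<n k 2
bit<2 (suc n) k = bit<2 n (k / 2)

T-not-≡ᵇ1 : ∀ {m} → m < 2 → T (not (m ≡ᵇ 1)) ⇔ m ≡ 0
T-not-≡ᵇ1 {0}           _ = mk⇔ (λ _ → refl) (λ _ → tt)
T-not-≡ᵇ1 {1}           _ = mk⇔ (λ ()) (λ ())
T-not-≡ᵇ1 {suc (suc m)} (s≤s (s≤s ()))

⟦⟧ᵉ-bit : ∀ n e k → T (⟦ e ⟧ᵉ (bit n k ≡ᵇ 1)) ⇔ InA n e k
⟦⟧ᵉ-bit n e0 k = mk⇔ _ _
⟦⟧ᵉ-bit n e1 k = mk⇔ (≡ᵇ⇒≡ _ 1) (≡⇒≡ᵇ _ 1)
⟦⟧ᵉ-bit n ec k = T-not-≡ᵇ1 (bit<2 n k)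

⟦monoTerm⟧-bits : ∀ {N} (U : Monomial N) k → T (⟦ monoTerm U ⟧ (bits k)) ⇔ InMono U k
⟦monoTerm⟧-bits U k = ∀-cong-⇔ (λ j → ⟦⟧ᵉ-bit (toℕ j) (lookup U j) k) ⇔-∘ ⟦monoTerm⟧ U (bits k)

⟦nfTerm⟧-bits : ∀ {N} (α : NF N) k → T (⟦ nfTerm α ⟧ (bits k)) ⇔ InA[ α ] k
⟦nfTerm⟧-bits []      k = mk⇔ (λ ()) (λ ())
⟦nfTerm⟧-bits (U ∷ α) k = begin
  T (⟦ monoTerm U ⟧ (bits k) ∨ ⟦ nfTerm α ⟧ (bits k))         ∼⟨ T-∨ ⟩
  (T (⟦ monoTerm U ⟧ (bits k)) ⊎ T (⟦ nfTerm α ⟧ (bits k)))   ∼⟨ ⟦monoTerm⟧-bits U k ⊎-⇔ ⟦nfTerm⟧-bits α k ⟩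
  (InMono U k ⊎ InA[ α ] k)                                   ↔⟨ ∷↔ (λ V → InMono V k) ⟩
  InA[ U ∷ α ] k                                              ∎
  where open Related.EquationalReasoning

⊨⇔InterSub : ∀ {I} (Ns : I → ℕ) (α : (i : I) → NF (Ns i)) {N} (β : NF N) J →
             (λ i → cls (Ns i) (nfTerm (α i))) ⊨[ J ] cls N (nfTerm β) ⇔ InterSub Ns α J β
⊨⇔InterSub Ns α β J = mk⇔
  (λ ⊨β k inαs → to (nf β k) (⊨β k (All.tabulate (λ {i} i∈J → from (nf (α i) k) (inαs i∈J)))))
  (λ ⊆β k holdαs → from (nf β k) (⊆β k (λ {i} i∈J → to (nf (α i) k) (All.lookup holdαs i∈J))))
  where nf = ⟦nfTerm⟧-bits

corollary4p15 : (I : Set) (Ns : I → ℕ) (α : (i : I) → NF (Ns i))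
                (N : ℕ) (β : NF N) →
                (((λ i → cls (Ns i) (nfTerm (α i))) ⊢ cls N (nfTerm β))
                  → Σ[ J ∈ List I ] InterSub Ns α J β)
                × ((Σ[ J ∈ List I ] InterSub Ns α J β)
                  → ((λ i → cls (Ns i) (nfTerm (α i))) ⊢ cls N (nfTerm β)))
corollary4p15 I Ns α N β =
  (λ Γ⊢β → generators Γ⊢β , to (⊨⇔InterSub Ns α β (generators Γ⊢β)) (⊢⇒⊨ Γ⊢β)) ,
  (λ (J , ⋂⊆Aβ) → ⊨⇒⊢ (from (⊨⇔InterSub Ns α β J) ⋂⊆Aβ))
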